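{- Let $G=([m]\cup[n],E)$ be a domination graph. If some left vertex $i\in[m]$ has degree zero in $G$, then for no $w$ does there exist a $G$-dominating injective map $\varphi:\{0,1\}^m\to\mathcal{B}(n,w)$.
   Context: For $y \in \{0,1\}^n$, $\mathrm{wt}(y)$ is the number of nonzero coordinates, and $\mathcal{B}(n,w)=\{y\in\{0,1\}^n : \mathrm{wt}(y)\le w\}$. A domination graph is a bipartite graph $G=([m]\cup[n],E)$ with left vertex set $[m]$ and right vertex set $[n]$ having no isolated right vertices. An injective map $\varphi:\{0,1\}^m\to\mathcal{B}(n,w)$ is $G$-dominating if for every $x\in\{0,1\}^m$ and every edge $(i,j)\in E$ ($i\in[m]$, $j\in[n]$): $x_i=0$ implies that the $j$-th coordinate of $\varphi(x)$ is $0$. -}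

module Defs where

open import Data.Nat using (ℕ; zero; suc; _≤_)
open import Data.Bool using (Bool; true; false)
open import Data.Fin using (Fin)
open import Data.Vec using (Vec; []; _∷_; lookup)
open import Data.Product using (∃)
open import Relation.Binary.PropositionalEquality using (_≡_)
open import Relation.Nullary using (¬_)
open import Function.Definitions using (Injective)

wt : ∀ {n} → Vec Bool n → ℕ
wt [] = zero
wt (true ∷ y) = suc (wt y)
wt (false ∷ y) = wt y

InBall : ∀ {n} → ℕ → Vec Bool n → Set
InBall w y = wt y ≤ w

IsDominationGraph : ∀ {m n} → (Fin m → Fin n → Set) → Set
IsDominationGraph {m} {n} E = (j : Fin n) → ∃ λ (i : Fin m) → E i j

DegreeZero : ∀ {m n} → (Fin m → Fin n → Set) → Fin m → Set
DegreeZero E i = ∀ j → ¬ E i j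

Dominates : ∀ {m n} → (Fin m → Fin n → Set) → (Vec Bool m → Vec Bool n) → Set
Dominates {m} {n} E φ =
  (x : Vec Bool m) (i : Fin m) (j : Fin n) → E i j →
  lookup x i ≡ false → lookup (φ x) j ≡ false

IsGDominatingMap : ∀ {m n} → (Fin m → Fin n → Set) → ℕ → (Vec Bool m → Vec Bool n) → Set
IsGDominatingMap E w φ =
  (∀ x → InBall w (φ x)) Data.Product.× Injective _≡_ _≡_ φ Data.Product.× Dominates E φ

module Submission where

-- Let φ be a G-dominating map.  Call x ∈ {0,1}^m silent if
-- x_{i'} = 0 for every left vertex i' that has at least one edge.  For a
-- silent x and any right vertex j, G being a domination graph gives an edge
-- (i', j); then x_{i'} = 0, so domination forces φ(x)_j = 0.  Hence every
-- silent x is mapped to the zero vector.  If the left vertex i is isolated,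
-- both the zero vector and the unit vector e_i are silent, so they share the
-- image 0; as e_i ≠ 0, φ is not injective.

open import Defs
open import Data.Nat using (ℕ)
open import Data.Bool using (Bool; true; false)
open import Data.Fin using (Fin)
open import Data.Vec using (Vec; lookup; replicate; tabulate; _[_]≔_)
open import Data.Vec.Properties
  using (tabulate∘lookup; tabulate-cong; lookup-replicate; lookup∘update; lookup∘update′)
open import Data.Product using (∃; _,_)
open import Relation.Nullary using (¬_)
open import Relation.Binary.PropositionalEquality

zeros : (k : ℕ) → Vec Bool k
zeros k = replicate k false

unit : ∀ {k} → Fin k → Vec Bool k
unit {k} i = zeros k [ i ]≔ true

lookup-ext : ∀ {A : Set} {k} (u v : Vec A k) → (∀ j → lookup u j ≡ lookup v j) → u ≡ v
lookup-ext u v same = begin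
  u                   ≡⟨ sym (tabulate∘lookup u) ⟩
  tabulate (lookup u) ≡⟨ tabulate-cong same ⟩
  tabulate (lookup v) ≡⟨ tabulate∘lookup v ⟩
  v                   ∎
  where open ≡-Reasoning

pointwise-zero : ∀ {k} (u : Vec Bool k) → (∀ j → lookup u j ≡ false) → u ≡ zeros k
pointwise-zero {k} u vanish =
  lookup-ext u (zeros k) (λ j → trans (vanish j) (sym (lookup-replicate j false)))

unit-off : ∀ {k} (i j : Fin k) → j ≢ i → lookup (unit i) j ≡ false
unit-off {k} i j j≢i = trans (lookup∘update′ j≢i (zeros k) true) (lookup-replicate j false)

unit≢zeros : ∀ {k} (i : Fin k) → unit i ≢ zeros k
unit≢zeros {k} i eq = true≢false (begin
  true                 ≡⟨ sym (lookup∘update i (zeros k) true) ⟩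
  lookup (unit i) i    ≡⟨ cong (λ u → lookup u i) eq ⟩
  lookup (zeros k) i   ≡⟨ lookup-replicate i false ⟩
  false                ∎)
  where
  open ≡-Reasoning
  true≢false : true ≢ false
  true≢false ()

Silent : ∀ {m n} → (Fin m → Fin n → Set) → Vec Bool m → Set
Silent E x = ∀ i j → E i j → lookup x i ≡ false

-- Main observation: on a domination graph, a dominating map sends every
-- silent input to the zero vector (each right vertex has a neighbour i',
-- and x_{i'} = 0 forces the corresponding output coordinate to 0).
dominating-silent : ∀ {m n} (E : Fin m → Fin n → Set) → IsDominationGraph E →
  (φ : Vec Bool m → Vec Bool n) → Dominates E φ →
  (x : Vec Bool m) → Silent E x → φ x ≡ zeros n
dominating-silent E graph φ dom x silent = pointwise-zero (φ x) vanish
  where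
  vanish : ∀ j → lookup (φ x) j ≡ false
  vanish j with graph j
  ... | i , edge = dom x i j edge (silent i j edge)

zeros-silent : ∀ {m n} (E : Fin m → Fin n → Set) → Silent E (zeros m)
zeros-silent E i j _ = lookup-replicate i false

-- If i has degree zero, the unit vector e_i is silent: an edge (i', j)
-- forces i' ≠ i, where e_i vanishes.
unit-silent : ∀ {m n} (E : Fin m → Fin n → Set) (i : Fin m) → DegreeZero E i →
  Silent E (unit i)
unit-silent E i isolated i' j edge = unit-off i i' i'≢i
  where
  i'≢i : i' ≢ i
  i'≢i refl = isolated j edge

lemma2 : ∀ {m n} (E : Fin m → Fin n → Set) → IsDominationGraph E →
    (i : Fin m) → DegreeZero E i →
    (w : ℕ) → ¬ (∃ λ (φ : Vec Bool m → Vec Bool n) → IsGDominatingMap E w φ)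
lemma2 {m} E graph i isolated w (φ , _ , injective , dom) =
  unit≢zeros i (injective same-image)
  where
  same-image : φ (unit i) ≡ φ (zeros m)
  same-image = trans (dominating-silent E graph φ dom (unit i) (unit-silent E i isolated))
                     (sym (dominating-silent E graph φ dom (zeros m) (zeros-silent E)))
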